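{- Let $\kappa$ be an infinite cardinal and $X\subseteq[\omega]^\omega$ with $|X|\ge\kappa$. The following are equivalent: (1) $X$ is $\kappa$-fin-unbounded; (2) for each $d\in[\omega]^\omega$ there is $S\subseteq X$ with $|S|<\kappa$ such that for every nonempty finite $F\subseteq X\setminus S$ we have $d\le^\infty\bigcup F$; (3) for each $d\in[\omega]^\omega$ there is $S\subseteq X$ with $|S|<\kappa$ such that for every nonempty finite $F\subseteq X\setminus S$ we have $d\le^\infty\min F$.
   Context: Each $a\in[\omega]^\omega$ is identified with its increasing enumeration in $\omega^\omega$. For $a,b$, $a\le^\infty b$ means $\{n:a(n)\le b(n)\}$ is infinite. For a nonempty finite $F\subseteq[\omega]^\omega$, $\min F$ is the function $n\mapsto\min\{x(n):x\in F\}$ (an element of $[\omega]^\omega$), and $\bigcup F\in[\omega]^\omega$ is the union of the sets. A set $x\subseteq\omega$ omits an interval of $a\in[\omega]^\omega$ if $x\cap[a(n),a(n+1))=\emptyset$ for some $n$. $X\subseteq[\omega]^\omega$ is $\kappa$-fin-unbounded if $|X|\ge\kappa$ and for every $d\in[\omega]^\omega$ there is $S\subseteq X$, $|S|<\kappa$, such that for every finite $F\subseteq X\setminus S$ the set $\bigcup F$ omits infinitely many intervals of $d$. -}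

module Defs where

open import Data.Nat using (ℕ; zero; suc; _≤_; _<_; _≤?_)
open import Data.Product using (Σ; ∃; _×_; _,_; proj₁)
open import Data.List using (List; []; _∷_)
open import Data.List.Relation.Unary.All using (All)
open import Data.List.Membership.Propositional using (_∈_)
open import Relation.Nullary using (¬_; yes; no)
open import Relation.Binary.PropositionalEquality using (_≡_; _≢_)
open import Function using (_⇔_)

-- Sequences ℕ → ℕ; an element of [ω]^ω is identified with its increasing
-- enumeration, i.e. a strictly increasing sequence.
Seq : Set
Seq = ℕ → ℕ

StrictInc : Seq → Set
StrictInc a = ∀ n → a n < a (suc n)

_≈s_ : Seq → Seq → Set
a ≈s b = ∀ n → a n ≡ b n

InfMany : (ℕ → Set) → Set
InfMany P = ∀ m → ∃ λ n → m ≤ n × P n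

_≤∞_ : Seq → Seq → Set
a ≤∞ b = InfMany (λ n → a n ≤ b n)

-- min F for a nonempty finite family, written x ∷ F
minF : Seq → List Seq → Seq
minF x []       n = x n
minF x (y ∷ F)  n with x n ≤? minF y F n
... | yes _ = x n
... | no  _ = minF y F n

-- least k ≤ m (searching from k₀ with fuel) such that m ≤ x k; for strictly
-- increasing x, m ≤ x m, so the search from 0 with fuel m+1 succeeds.
search : Seq → ℕ → ℕ → ℕ → ℕ
search x m k zero = k
search x m k (suc fuel) with m ≤? x k
... | yes _ = k
... | no  _ = search x m (suc k) fuel

nextIn : Seq → ℕ → ℕ
nextIn x m = x (search x m 0 (suc m))

nextUnion : Seq → List Seq → ℕ → ℕ
nextUnion x []      m = nextIn x m
nextUnion x (y ∷ F) m with nextIn x m ≤? nextUnion y F m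
... | yes _ = nextIn x m
... | no  _ = nextUnion y F m

-- increasing enumeration of ⋃(x ∷ F) (for strictly increasing members)
unionF : Seq → List Seq → Seq
unionF x F zero    = nextUnion x F 0
unionF x F (suc n) = nextUnion x F (suc (unionF x F n))

InUnion : ℕ → List Seq → Set
InUnion m F = ∃ λ x → x ∈ F × ∃ λ k → x k ≡ m

OmitsInterval : List Seq → Seq → ℕ → Set
OmitsInterval F d n = ∀ m → d n ≤ m → m < d (suc n) → ¬ InUnion m F

-- Cardinalities.  A cardinal κ is represented by a type K (with ≡);
-- a subset S ⊆ [ω]^ω by a predicate S : Seq → Set whose elements are
-- compared by pointwise equality.

Elems : (Seq → Set) → Set
Elems S = Σ Seq S

_≼K_ : (Seq → Set) → Set → Set
S ≼K K = Σ (Elems S → K) λ f →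
           (∀ p q → proj₁ p ≈s proj₁ q → f p ≡ f q) ×
           (∀ p q → f p ≡ f q → proj₁ p ≈s proj₁ q)

_K≼_ : Set → (Seq → Set) → Set
K K≼ S = Σ (K → Elems S) λ g → ∀ k k′ → proj₁ (g k) ≈s proj₁ (g k′) → k ≡ k′

_≺K_ : (Seq → Set) → Set → Set
S ≺K K = S ≼K K × ¬ (K K≼ S)

InfiniteType : Set → Set
InfiniteType K = Σ (ℕ → K) λ f → ∀ i j → f i ≡ f j → i ≡ j

_⊆s_ : (Seq → Set) → (Seq → Set) → Set
S ⊆s X = ∀ x → S x → X x

FinIn : (Seq → Set) → (Seq → Set) → List Seq → Set
FinIn X S F = All (λ x → X x × ¬ S x) F

FinUnbounded : Set → (Seq → Set) → Set₁
FinUnbounded K X = K K≼ X ×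
  (∀ d → StrictInc d → Σ (Seq → Set) λ S → S ⊆s X × S ≺K K ×
     ∀ F → FinIn X S F → InfMany (OmitsInterval F d))

Cond2 : Set → (Seq → Set) → Set₁
Cond2 K X = ∀ d → StrictInc d → Σ (Seq → Set) λ S → S ⊆s X × S ≺K K ×
     ∀ x F → FinIn X S (x ∷ F) → d ≤∞ unionF x F

Cond3 : Set → (Seq → Set) → Set₁
Cond3 K X = ∀ d → StrictInc d → Σ (Seq → Set) λ S → S ⊆s X × S ≺K K ×
     ∀ x F → FinIn X S (x ∷ F) → d ≤∞ minF x F

-- (2) ⇒ (3): the n-th element of ⋃F is at most the n-th element of every
-- member of F, hence at most (min F)(n).
-- (1) ⇒ (2): apply (1) to the sequence e with e(i+1) = d(e i) + 1.  If ⋃F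
-- misses the interval [e i, d(e i)], its (e i)-th element, being ≥ e i,
-- exceeds d(e i).
-- (3) ⇒ (1): apply (3) to n ↦ d(1 + n + n²).  If m, |F| ≤ n and every member
-- of F has its n-th element above d(1 + n + n²) ≥ d(m + |F| n + 1), then ⋃F
-- has at most |F| n elements below d(m + |F| n + 1), too few to meet all of
-- the |F| n + 1 intervals m, …, m + |F| n of d.
-- In each case the exceptional set S for the new sequence serves for d.
{-# OPTIONS --safe #-}
module Submission where

open import Defs
open import Data.Product using (_×_)
open import Function using (_⇔_)

open import Data.List using (List; []; _∷_; length; replicate)
open import Data.List.Membership.Propositional using (_∈_)
open import Data.List.Relation.Binary.Pointwise using (Pointwise; []; _∷_)
import Data.List.Relation.Binary.Pointwise as Pointwise
open import Data.List.Relation.Unary.All using (All; []; _∷_)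
import Data.List.Relation.Unary.All as All
open import Data.List.Relation.Unary.Any using (here; there)
open import Data.Nat
open import Data.Nat.ListAction using (sum)
open import Data.Nat.Properties
open import Data.Product using (Σ; ∃; _,_; proj₁)
import Data.Product as Product
open import Data.Sum using (_⊎_; inj₁; inj₂; [_,_]′)
import Data.Sum as Sum
open import Function using (_∘_; id; mk⇔)
open import Level using (0ℓ)
open import Relation.Binary.PropositionalEquality
open import Relation.Nullary using (¬_; yes; no; contradiction)
open import Relation.Unary using (Pred; _∪_; _⊆_; _≐_)

private
  variable
    a d x y : Seq
    F L : List Seq
    i j m n v D D′ : ℕ
    js : List ℕ
    P Q : Pred ℕ 0ℓ

strictInc-mono-≤ : StrictInc a → i ≤ j → a i ≤ a j
strictInc-mono-≤ {a} sa = go ∘ ≤⇒≤′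
  where
  go : i ≤′ j → a i ≤ a j
  go ≤′-refl       = ≤-refl
  go (≤′-step i≤j) = ≤-trans (go i≤j) (<⇒≤ (sa _))

strictInc-mono-< : StrictInc a → i < j → a i < a j
strictInc-mono-< {i = i} sa i<j = ≤-trans (sa i) (strictInc-mono-≤ sa i<j)

n≤strictInc : StrictInc a → ∀ n → n ≤ a n
n≤strictInc sa zero    = z≤n
n≤strictInc sa (suc n) = ≤-trans (s≤s (n≤strictInc sa n)) (sa n)

∘-strictInc : {f : Seq} → StrictInc d → StrictInc f → StrictInc (d ∘ f)
∘-strictInc sd sf n = strictInc-mono-< sd (sf n)

≤∞-≤-trans : {b c : Seq} → a ≤∞ b → (∀ n → b n ≤ c n) → a ≤∞ c
≤∞-≤-trans a≤∞b b≤c m =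
  Product.map₂ (λ {n} → Product.map₂ λ aₙ≤bₙ → ≤-trans aₙ≤bₙ (b≤c n)) (a≤∞b m)

InRange : Seq → Pred ℕ 0ℓ
InRange x v = ∃ λ k → x k ≡ v

⋃ : List Seq → Pred ℕ 0ℓ
⋃ L v = InUnion v L

⋃-∷ : ⋃ (x ∷ F) ≐ InRange x ∪ ⋃ F
⋃-∷ = (λ { (_ , here refl , k) → inj₁ k ; (z , there z∈F , k) → inj₂ (z , z∈F , k) })
    , [ (λ k → _ , here refl , k) , (λ { (z , z∈F , k) → z , there z∈F , k }) ]′

⋃-[_] : ∀ x → ⋃ (x ∷ []) ≐ InRange x
⋃-[ x ] = (λ { (_ , here refl , k) → k ; (_ , there () , _) }) , (λ k → x , here refl , k)

record LeastAbove (m : ℕ) (P : Pred ℕ 0ℓ) (v : ℕ) : Set where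
  field
    above  : m ≤ v
    member : P v
    least  : ∀ {w} → P w → m ≤ w → v ≤ w

open LeastAbove

LeastAbove-resp : P ≐ Q → LeastAbove m P v → LeastAbove m Q v
LeastAbove-resp (P⊆Q , Q⊆P) lv = record
  { above = above lv ; member = P⊆Q (member lv) ; least = least lv ∘ Q⊆P }

least-∪ : {u v : ℕ} → u ≤ v → LeastAbove m P u → LeastAbove m Q v → LeastAbove m (P ∪ Q) u
least-∪ u≤v lu lv = record
  { above  = above lu
  ; member = inj₁ (member lu)
  ; least  = [ least lu , (λ Qw m≤w → ≤-trans u≤v (least lv Qw m≤w)) ]′
  }

search-≤ : ∀ {k} fuel → k ≤ j → m ≤ x j → search x m k fuel ≤ j
search-≤ zero k≤j _ = k≤j
search-≤ {j} {m} {x} {k} (suc fuel) k≤j m≤xj with m ≤? x k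
... | yes _   = k≤j
... | no m≰xk = search-≤ fuel (≤∧≢⇒< k≤j λ { refl → m≰xk m≤xj }) m≤xj

search-found : ∀ x m k fuel → m ≤ x (search x m k fuel) ⊎ search x m k fuel ≡ k + fuel
search-found x m k zero = inj₂ (sym (+-identityʳ k))
search-found x m k (suc fuel) with m ≤? x k
... | yes m≤xk = inj₁ m≤xk
... | no _     = Sum.map₂ (λ eq → trans eq (sym (+-suc k fuel))) (search-found x m (suc k) fuel)

nextIn-least : StrictInc x → ∀ m → LeastAbove m (InRange x) (nextIn x m)
nextIn-least {x} sx m = record
  { above  = [ id , (λ exhausted → contradiction (subst (_≤ m) exhausted searched≤m) 1+n≰n) ]′
               (search-found x m 0 (suc m))
  ; member = _ , refl
  ; least  = λ { (j , refl) m≤xj → strictInc-mono-≤ sx (search-≤ (suc m) z≤n m≤xj) }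
  }
  where
  searched≤m : search x m 0 (suc m) ≤ m
  searched≤m = search-≤ (suc m) z≤n (n≤strictInc sx m)

nextUnion-least : All StrictInc (x ∷ F) → ∀ m → LeastAbove m (⋃ (x ∷ F)) (nextUnion x F m)
nextUnion-least {x} {[]} (sx ∷ []) m =
  LeastAbove-resp (Product.swap ⋃-[ x ]) (nextIn-least sx m)
nextUnion-least {x} {y ∷ F} (sx ∷ sF) m with nextIn x m ≤? nextUnion y F m
... | yes u≤v = LeastAbove-resp (Product.swap ⋃-∷)
                  (least-∪ u≤v (nextIn-least sx m) (nextUnion-least sF m))
... | no u≰v  = LeastAbove-resp (Product.swap ⋃-∷)
                  (LeastAbove-resp (Sum.swap , Sum.swap)
                    (least-∪ (<⇒≤ (≰⇒> u≰v)) (nextUnion-least sF m) (nextIn-least sx m)))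

unionF-strictInc : All StrictInc (x ∷ F) → StrictInc (unionF x F)
unionF-strictInc {x} {F} sxF n = above (nextUnion-least sxF (suc (unionF x F n)))

unionF-∈ : All StrictInc (x ∷ F) → ∀ n → ⋃ (x ∷ F) (unionF x F n)
unionF-∈ sxF zero    = member (nextUnion-least sxF 0)
unionF-∈ sxF (suc n) = member (nextUnion-least sxF _)

unionF-≤ : All StrictInc (x ∷ F) → y ∈ x ∷ F → ∀ n → unionF x F n ≤ y n
unionF-≤ {y = y} sxF y∈ zero = least (nextUnion-least sxF 0) (y , y∈ , 0 , refl) z≤n
unionF-≤ {x} {F} {y} sxF y∈ (suc n) =
  least (nextUnion-least sxF (suc (unionF x F n))) (y , y∈ , suc n , refl)
        (≤-trans (s≤s (unionF-≤ sxF y∈ n)) (All.lookup sxF y∈ n))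

minF-attained : ∀ x F n → ∃ λ y → y ∈ x ∷ F × minF x F n ≡ y n
minF-attained x []      n = x , here refl , refl
minF-attained x (z ∷ F) n with x n ≤? minF z F n
... | yes _ = x , here refl , refl
... | no _  = Product.map₂ (Product.map₁ there) (minF-attained z F n)

minF-≤ : ∀ x F n → y ∈ x ∷ F → minF x F n ≤ y n
minF-≤ x []      n (here refl) = ≤-refl
minF-≤ x []      n (there ())
minF-≤ x (z ∷ F) n y∈ with x n ≤? minF z F n | y∈
... | yes _     | here refl = ≤-refl
... | yes xₙ≤   | there y∈F = ≤-trans xₙ≤ (minF-≤ z F n y∈F)
... | no xₙ≰    | here refl = <⇒≤ (≰⇒> xₙ≰)
... | no _      | there y∈F = minF-≤ z F n y∈F

unionF≤minF : All StrictInc (x ∷ F) → ∀ n → unionF x F n ≤ minF x F n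
unionF≤minF {x} {F} sxF n with minF-attained x F n
... | y , y∈ , minₙ≡yₙ = subst (unionF x F n ≤_) (sym minₙ≡yₙ) (unionF-≤ sxF y∈ n)

Avoids : ℕ → ℕ → Pred ℕ 0ℓ → Set
Avoids D′ D P = ∀ m → D′ ≤ m → m < D → ¬ P m

Avoids-∪ : Avoids D′ D P → Avoids D′ D Q → Avoids D′ D (P ∪ Q)
Avoids-∪ avoidP avoidQ m D′≤m m<D = [ avoidP m D′≤m m<D , avoidQ m D′≤m m<D ]′

Avoids-⊆ : P ⊆ Q → Avoids D′ D Q → Avoids D′ D P
Avoids-⊆ P⊆Q avoidQ m D′≤m m<D = avoidQ m D′≤m m<D ∘ P⊆Q

-- With these cursors, ⋃ L has at most sum js elements below D.
Cursors : ℕ → List Seq → List ℕ → Set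
Cursors D = Pointwise (λ y j → D ≤ y j)

retreat : StrictInc y → D′ ≤ D → D ≤ y j →
  (∃ λ j′ → suc j′ ≡ j × D′ ≤ y j′) ⊎ Avoids D′ D (InRange y)
retreat {y} {j = zero} sy _ D≤y₀ = inj₂ λ { _ _ yₖ<D (k , refl) →
  <⇒≱ yₖ<D (≤-trans D≤y₀ (strictInc-mono-≤ sy z≤n)) }
retreat {y} {D′} {j = suc j} sy _ D≤y₁₊ⱼ with D′ ≤? y j
... | yes D′≤yⱼ = inj₁ (j , refl , D′≤yⱼ)
... | no D′≰yⱼ  = inj₂ λ { _ D′≤yₖ yₖ<D (k , refl) →
  [ (λ k≤j → D′≰yⱼ (≤-trans D′≤yₖ (strictInc-mono-≤ sy k≤j)))
  , (λ j<k → <⇒≱ yₖ<D (≤-trans D≤y₁₊ⱼ (strictInc-mono-≤ sy j<k)))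
  ]′ (≤-<-connex k j) }

retreat-all : All StrictInc L → D′ ≤ D → Cursors D L js →
  (∃ λ js′ → suc (sum js′) ≡ sum js × Cursors D′ L js′) ⊎ Avoids D′ D (⋃ L)
retreat-all [] _ [] = inj₂ λ { _ _ _ (_ , () , _) }
retreat-all (sy ∷ sL) D′≤D (D≤yⱼ ∷ cs) with retreat sy D′≤D D≤yⱼ | retreat-all sL D′≤D cs
... | inj₁ (j′ , refl , D′≤yⱼ′) | _ =
  inj₁ (j′ ∷ _ , refl , D′≤yⱼ′ ∷ Pointwise.map (≤-trans D′≤D) cs)
... | inj₂ _ | inj₁ (js′ , sum≡ , cs′) =
  inj₁ (_ ∷ js′ , trans (sym (+-suc _ _)) (cong (_ +_) sum≡) , ≤-trans D′≤D D≤yⱼ ∷ cs′)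
... | inj₂ gap | inj₂ avoid = inj₂ (Avoids-⊆ (proj₁ ⋃-∷) (Avoids-∪ gap avoid))

-- Lowering the threshold from d (a + N + 1) to d (a + N) either moves one
-- cursor back, or shows that the interval a + N is omitted.
omitted-interval : StrictInc d → All StrictInc L → ∀ a N → sum js ≡ N →
  Cursors (d (suc (a + N))) L js → ∃ λ i → a ≤ i × OmitsInterval L d i
omitted-interval sd sL a N sum≡N cs with retreat-all sL (<⇒≤ (sd (a + N))) cs
... | inj₂ avoid = a + N , m≤m+n a N , avoid
omitted-interval sd sL a zero sum≡0 cs | inj₁ (_ , suc≡ , _) =
  contradiction (trans suc≡ sum≡0) λ ()
omitted-interval {d} {L} sd sL a (suc N) sum≡ cs | inj₁ (js′ , suc≡ , cs′) =
  omitted-interval sd sL a N (suc-injective (trans suc≡ sum≡))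
    (subst (λ t → Cursors (d t) L js′) (+-suc a N) cs′)

sum-replicate : ∀ k n → sum (replicate k n) ≡ k * n
sum-replicate zero    n = refl
sum-replicate (suc k) n = cong (n +_) (sum-replicate k n)

cursors-replicate : All (λ y → D ≤ y n) L → Cursors D L (replicate (length L) n)
cursors-replicate []         = []
cursors-replicate (D≤yₙ ∷ L) = D≤yₙ ∷ cursors-replicate L

pigeonhole-omits : StrictInc d → All StrictInc L → ∀ a n →
  All (λ y → d (suc (a + length L * n)) ≤ y n) L → ∃ λ i → a ≤ i × OmitsInterval L d i
pigeonhole-omits {L = L} sd sL a n beyond =
  omitted-interval sd sL a (length L * n) (sum-replicate (length L) n) (cursors-replicate beyond)

hops : Seq → Seq
hops d zero    = 0
hops d (suc i) = suc (d (hops d i))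

hops-strictInc : StrictInc d → StrictInc (hops d)
hops-strictInc {d} sd i = s≤s (n≤strictInc sd (hops d i))

omits-hops⇒≤∞unionF : StrictInc d → All StrictInc (x ∷ F) →
  InfMany (OmitsInterval (x ∷ F) (hops d)) → d ≤∞ unionF x F
omits-hops⇒≤∞unionF {d} {x} {F} sd sxF omits m =
  let i , m≤i , omit = omits m
      h = hops d i
  in h , ≤-trans m≤i (n≤strictInc (hops-strictInc sd) i) ,
     <⇒≤ (≮⇒≥ λ u<1+dh →
       omit (unionF x F h) (n≤strictInc (unionF-strictInc sxF) h) u<1+dh (unionF-∈ sxF h))

quadratic : Seq
quadratic n = suc (n + n * n)

quadratic-strictInc : StrictInc quadratic
quadratic-strictInc n = s≤s (s≤s (+-monoʳ-≤ n (*-mono-≤ (n≤1+n n) (n≤1+n n))))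

≤∞minF⇒omits : StrictInc d → All StrictInc (x ∷ F) →
  (d ∘ quadratic) ≤∞ minF x F → InfMany (OmitsInterval (x ∷ F) d)
≤∞minF⇒omits {d} {x} {F} sd sxF d≤∞min m =
  let k = length (x ∷ F)
      n , m⊔k≤n , d≤minₙ = d≤∞min (m ⊔ k)
      bound : suc (m + k * n) ≤ quadratic n
      bound = s≤s (+-mono-≤ (≤-trans (m≤m⊔n m k) m⊔k≤n)
                            (*-monoˡ-≤ n (≤-trans (m≤n⊔m m k) m⊔k≤n)))
  in pigeonhole-omits sd sxF m n (All.tabulate λ y∈ →
       ≤-trans (strictInc-mono-≤ sd bound) (≤-trans d≤minₙ (minF-≤ x F n y∈)))

SmallExceptions : Set → (Seq → Set) → (Seq → (Seq → Set) → Set) → Set₁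
SmallExceptions K X R = ∀ d → StrictInc d → Σ (Seq → Set) λ S → S ⊆s X × S ≺K K × R d S

SmallExceptions-map : ∀ {K X R R′} (e : Seq → Seq) → (∀ {d} → StrictInc d → StrictInc (e d)) →
  (∀ {d S} → StrictInc d → R (e d) S → R′ d S) →
  SmallExceptions K X R → SmallExceptions K X R′
SmallExceptions-map e se f small d sd =
  Product.map₂ (Product.map₂ (Product.map₂ (f sd))) (small (e d) (se sd))

module _ {K : Set} {X : Seq → Set} (X-strictInc : ∀ x → X x → StrictInc x) where

  finIn-strictInc : ∀ {S} → FinIn X S F → All StrictInc F
  finIn-strictInc = All.map λ { {x} (x∈X , _) → X-strictInc x x∈X }

  finUnbounded⇒cond2 : FinUnbounded K X → Cond2 K X
  finUnbounded⇒cond2 (_ , small) = SmallExceptions-map hops hops-strictInc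
    (λ sd omits x F fin → omits-hops⇒≤∞unionF sd (finIn-strictInc fin) (omits (x ∷ F) fin))
    small

  cond2⇒cond3 : Cond2 K X → Cond3 K X
  cond2⇒cond3 = SmallExceptions-map id id
    (λ _ d≤∞∪ x F fin → ≤∞-≤-trans (d≤∞∪ x F fin) (unionF≤minF (finIn-strictInc fin)))

  cond3⇒finUnbounded : K K≼ X → Cond3 K X → FinUnbounded K X
  cond3⇒finUnbounded K≼X c3 = K≼X ,
    SmallExceptions-map (_∘ quadratic) (λ sd → ∘-strictInc sd quadratic-strictInc) omits c3
    where
    omits : ∀ {d S} → StrictInc d → (∀ x F → FinIn X S (x ∷ F) → (d ∘ quadratic) ≤∞ minF x F) →
      ∀ F → FinIn X S F → InfMany (OmitsInterval F d)
    omits _  _     []      _   m = m , ≤-refl , λ { _ _ _ (_ , () , _) }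
    omits sd d≤min (x ∷ F) fin   = ≤∞minF⇒omits sd (finIn-strictInc fin) (d≤min x F fin)

-- The argument works for every K.
proposition3p2 : (K : Set) → InfiniteType K →
    (X : Seq → Set) → (∀ x → X x → StrictInc x) → K K≼ X →
    (FinUnbounded K X ⇔ Cond2 K X) × (FinUnbounded K X ⇔ Cond3 K X)
proposition3p2 K _ X X-strictInc K≼X =
  mk⇔ (finUnbounded⇒cond2 X-strictInc)
      (cond3⇒finUnbounded X-strictInc K≼X ∘ cond2⇒cond3 X-strictInc) ,
  mk⇔ (cond2⇒cond3 X-strictInc ∘ finUnbounded⇒cond2 X-strictInc)
      (cond3⇒finUnbounded X-strictInc K≼X)
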